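{- For every non-negative integer $\alpha$, \[3\cdot 2^{\alpha+3} \;\Big|\; \sum_{i=1}^{3\cdot 2^{\alpha+3}} F_i = F_{3\cdot 2^{\alpha+3}+2}-1,\] where $(F_n)_{n\ge 0}$ is the Fibonacci sequence.
   Context: The Fibonacci numbers are defined by $F_0=0$, $F_1=1$, and $F_{n+1}=F_n+F_{n-1}$ for $n\ge 1$. -}

module Defs where

open import Data.Nat using (ℕ; zero; suc; _+_)

fib : ℕ → ℕ
fib zero = 0
fib (suc zero) = 1
fib (suc (suc n)) = fib (suc n) + fib n

fibSum : ℕ → ℕ
fibSum zero = 0
fibSum (suc n) = fibSum n + fib (suc n)

module Submission where

-- Write m = j + 1.  Call j "good" (record GoodIndex) when
--   F_m ≡ 0 (mod 4m)   and   F_j ≡ 1 (mod 2m),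
-- with the quotients recorded as explicit witnesses.  Three facts drive the proof:
--   * the addition formula F_{m+n+1} = F_{m+1} F_{n+1} + F_m F_n (fib-add);
--   * goodness doubles: if j is good then so is 2j + 1, i.e. m ↦ 2m (good-double),
--     by the doubling formulas F_{2m} = F_m (F_m + 2 F_{m-1}), F_{2m-1} = F_m² + F_{m-1}²;
--   * the closed form Σ_{i=1}^{n} F_i = F_{n+2} - 1 (fibSum-closed).
-- Since 23 is good (F_24 = 46368 = 96·483 and F_23 = 28657 = 1 + 48·597), doubling
-- α times shows that M - 1 is good for M = 3·2^(α+3).  For a good index,
-- F_{M+2} = 2 F_M + F_{M-1} ≡ 1 (mod M), so M divides F_{M+2} - 1 = Σ_{i=1}^{M} F_i.

open import Defs
open import Data.Nat using (ℕ; zero; suc; _+_; _*_; _∸_; _^_)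
open import Data.Nat.Divisibility using (_∣_; divides)
open import Data.Nat.Properties using (+-suc; +-comm; +-cancelʳ-≡; m+n∸n≡m)
open import Data.Product using (Σ-syntax; _×_; _,_)
open import Relation.Binary.PropositionalEquality
  using (_≡_; refl; sym; cong; cong₂; subst; module ≡-Reasoning)
open import Data.Nat.Solver using (module +-*-Solver)
open +-*-Solver using (solve; _:=_; _:+_; _:*_; con)

fib-add : ∀ m n → fib (suc (m + n)) ≡ fib (suc m) * fib (suc n) + fib m * fib n
fib-add zero n = solve 1 (λ f → f := con 1 :* f :+ con 0 :* con 0) refl (fib (suc n))
fib-add (suc m) n = begin
    fib (suc (suc m + n))
      ≡⟨ cong (λ k → fib (suc k)) (sym (+-suc m n)) ⟩
    fib (suc (m + suc n))
      ≡⟨ fib-add m (suc n) ⟩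
    fib (suc m) * (fib (suc n) + fib n) + fib m * fib (suc n)
      ≡⟨ solve 4 (λ a b c d → a :* (c :+ d) :+ b :* c := (a :+ b) :* c :+ a :* d)
           refl (fib (suc m)) (fib m) (fib (suc n)) (fib n) ⟩
    (fib (suc m) + fib m) * fib (suc n) + fib (suc m) * fib n ∎
  where open ≡-Reasoning

fibSum-plus-one : ∀ n → fibSum n + 1 ≡ fib (suc (suc n))
fibSum-plus-one zero = refl
fibSum-plus-one (suc n) = begin
    fibSum n + fib (suc n) + 1
      ≡⟨ solve 2 (λ s f → s :+ f :+ con 1 := (s :+ con 1) :+ f) refl (fibSum n) (fib (suc n)) ⟩
    fibSum n + 1 + fib (suc n)
      ≡⟨ cong (_+ fib (suc n)) (fibSum-plus-one n) ⟩
    fib (suc (suc (suc n))) ∎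
  where open ≡-Reasoning

fibSum-closed : ∀ n → fibSum n ≡ fib (n + 2) ∸ 1
fibSum-closed n = begin
    fibSum n                        ≡⟨ sym (m+n∸n≡m (fibSum n) 1) ⟩
    fibSum n + 1 ∸ 1                ≡⟨ cong (_∸ 1) (fibSum-plus-one n) ⟩
    fib (suc (suc n)) ∸ 1           ≡⟨ cong (λ k → fib k ∸ 1) (+-comm 2 n) ⟩
    fib (n + 2) ∸ 1 ∎
  where open ≡-Reasoning

record GoodIndex (j : ℕ) : Set where
  field
    a c   : ℕ
    fib-m : fib (suc j) ≡ suc j * 4 * a
    fib-j : fib j ≡ 1 + suc j * 2 * c

-- Goodness passes from m = j + 1 to 2m = (2j + 1) + 1.  With x = F_m, z = F_j the
-- addition formula gives F_{2m} = x(x + z) + xz and F_{2m-1} = x² + z², and both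
-- congruences follow by expanding x = 4ma, z = 1 + 2mc.
good-double : ∀ {j} → GoodIndex j → GoodIndex (suc (j + j))
good-double {j} g = record
  { a     = a * (1 + m * 2 * a + m * 2 * c)
  ; c     = 4 * m * a * a + c + m * c * c
  ; fib-m = begin
      fib (suc (suc j + j))
        ≡⟨ fib-add (suc j) j ⟩
      (fib (suc j) + fib j) * fib (suc j) + fib (suc j) * fib j
        ≡⟨ cong₂ (λ x z → (x + z) * x + x * z) fib-m fib-j ⟩
      (m * 4 * a + (1 + m * 2 * c)) * (m * 4 * a) + m * 4 * a * (1 + m * 2 * c)
        ≡⟨ solve 3 (λ j a c →
               let m = con 1 :+ j in
               (m :* con 4 :* a :+ (con 1 :+ m :* con 2 :* c)) :* (m :* con 4 :* a)
                 :+ m :* con 4 :* a :* (con 1 :+ m :* con 2 :* c)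
               := (con 1 :+ (con 1 :+ (j :+ j))) :* con 4
                    :* (a :* (con 1 :+ m :* con 2 :* a :+ m :* con 2 :* c)))
             refl j a c ⟩
      suc (suc (j + j)) * 4 * (a * (1 + m * 2 * a + m * 2 * c)) ∎
  ; fib-j = begin
      fib (suc (j + j))
        ≡⟨ fib-add j j ⟩
      fib (suc j) * fib (suc j) + fib j * fib j
        ≡⟨ cong₂ (λ x z → x * x + z * z) fib-m fib-j ⟩
      m * 4 * a * (m * 4 * a) + (1 + m * 2 * c) * (1 + m * 2 * c)
        ≡⟨ solve 3 (λ j a c →
               let m = con 1 :+ j in
               m :* con 4 :* a :* (m :* con 4 :* a)
                 :+ (con 1 :+ m :* con 2 :* c) :* (con 1 :+ m :* con 2 :* c)
               := con 1 :+ (con 1 :+ (con 1 :+ (j :+ j))) :* con 2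
                    :* (con 4 :* m :* a :* a :+ c :+ m :* c :* c))
             refl j a c ⟩
      1 + suc (suc (j + j)) * 2 * (4 * m * a * a + c + m * c * c) ∎
  }
  where
  open GoodIndex g
  open ≡-Reasoning
  m : ℕ
  m = suc j

-- If j is good then m = j + 1 divides Σ_{i=1}^{m} F_i, because
-- Σ_{i=1}^{m} F_i + 1 = F_{m+2} = 2 F_m + F_j = (8a + 2c)·m + 1.
good⇒divides-fibSum : ∀ {j} → GoodIndex j → suc j ∣ fibSum (suc j)
good⇒divides-fibSum {j} g = divides (8 * a + 2 * c) (+-cancelʳ-≡ 1 _ _ (begin
    fibSum m + 1
      ≡⟨ fibSum-plus-one m ⟩
    (fib m + fib j) + fib m
      ≡⟨ cong₂ (λ x z → (x + z) + x) fib-m fib-j ⟩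
    (m * 4 * a + (1 + m * 2 * c)) + m * 4 * a
      ≡⟨ solve 3 (λ m a c → (m :* con 4 :* a :+ (con 1 :+ m :* con 2 :* c)) :+ m :* con 4 :* a
                   := (con 8 :* a :+ con 2 :* c) :* m :+ con 1) refl m a c ⟩
    (8 * a + 2 * c) * m + 1 ∎))
  where
  open GoodIndex g
  open ≡-Reasoning
  m : ℕ
  m = suc j

good-at-3·2^ : ∀ α → Σ[ j ∈ ℕ ] suc j ≡ 3 * 2 ^ (α + 3) × GoodIndex j
good-at-3·2^ zero = 23 , refl , record { a = 483 ; c = 597 ; fib-m = refl ; fib-j = refl }
good-at-3·2^ (suc α) with good-at-3·2^ α
... | j , m≡M , g = suc (j + j) , doubled , good-double g
  where
  open ≡-Reasoning
  doubled : suc (suc (j + j)) ≡ 3 * (2 * 2 ^ (α + 3))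
  doubled = begin
    suc (suc (j + j))        ≡⟨ solve 1 (λ j → con 1 :+ (con 1 :+ (j :+ j))
                                          := con 2 :* (con 1 :+ j)) refl j ⟩
    2 * suc j                ≡⟨ cong (2 *_) m≡M ⟩
    2 * (3 * 2 ^ (α + 3))    ≡⟨ solve 1 (λ p → con 2 :* (con 3 :* p) := con 3 :* (con 2 :* p))
                                  refl (2 ^ (α + 3)) ⟩
    3 * (2 * 2 ^ (α + 3)) ∎

mainTheorem6 : (α : ℕ) →
    (3 * 2 ^ (α + 3)) ∣ fibSum (3 * 2 ^ (α + 3))
    × fibSum (3 * 2 ^ (α + 3)) ≡ fib (3 * 2 ^ (α + 3) + 2) ∸ 1
mainTheorem6 α with good-at-3·2^ α
... | j , m≡M , g =
  subst (λ m → m ∣ fibSum m) m≡M (good⇒divides-fibSum g) , fibSum-closed (3 * 2 ^ (α + 3))
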